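{- $\mathrm{GNFO}\not\le_{\mathbb K}\mathrm{UCPDL}^+$.
   Context: Relation names have arities $\ge1$ (unary: atomic propositions; binary: atomic programs); a $\sigma$-structure $K$ has domain $\mathrm{dom}(K)$ and relations $R^K\subseteq\mathrm{dom}(K)^{\mathrm{ar}(R)}$; it is a Kripke structure if all relations of arity $>2$ are empty. $\mathrm{UCPDL}^+$: formulas $\varphi::=p\mid\neg\varphi\mid\varphi\wedge\varphi\mid\langle\pi\rangle$, programs $\pi::=\varepsilon\mid a\mid\bar a\mid\mathbb U\mid\pi\cup\pi\mid\pi\circ\pi\mid\pi^*\mid\varphi?\mid C[x_s,x_t]$, with semantics $[\![p]\!]=p^K$; complement; intersection; $[\![\langle\pi\rangle]\!]=\{u:\exists v\,(u,v)\in[\![\pi]\!]\}$; identity; $a^K$; converse of $a^K$; $[\![\mathbb U]\!]=\mathrm{dom}(K)^2$; union; composition; reflexive-transitive closure; $\{(u,u):u\in[\![\varphi]\!]\}$. In $C[x_s,x_t]$, $C$ is a finite set of atoms, each a p-atom $\pi(x,x')$ or an r-atom $R(x_1,\dots,x_n)$ with $\mathrm{ar}(R)=n>2$; $x_s,x_t\in\mathrm{Vars}(C)$; the graph on $\mathrm{Vars}(C)$ linking variables in a common atom is connected; $[\![C[x_s,x_t]]\!]_K$ is the set of $(f(x_s),f(x_t))$ for maps $f:\mathrm{Vars}(C)\to\mathrm{dom}(K)$ satisfying all atoms. GNFO (guarded negation first-order logic) is the fragment of first-order logic with equality given by $\varphi::=P(\bar x)\mid x=y\mid\varphi\vee\varphi\mid\varphi\wedge\varphi\mid\exists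 x\,\varphi\mid\alpha(\bar x\bar y)\wedge\neg\varphi(\bar y)$, where $P$ is a relation symbol, $\alpha$ is a relation atom or an equality whose free variables include all free variables $\bar y$ of $\varphi$. $\mathrm{GNFO}\le_{\mathbb K}\mathrm{UCPDL}^+$ would mean there is a translation $T$ mapping each GNFO formula $\varphi(x)$ with exactly one free variable to a $\mathrm{UCPDL}^+$-formula with $K\models\varphi[x\mapsto u]$ iff $u\in[\![T(\varphi)]\!]_K$, and each GNFO formula $\varphi(x,y)$ with exactly two distinct free variables to a $\mathrm{UCPDL}^+$-program with $K\models\varphi[x\mapsto u,y\mapsto v]$ iff $(u,v)\in[\![T(\varphi)]\!]_K$, for all Kripke structures $K$ and worlds $u,v$. -}

module Defs where

open import Data.Nat using (ℕ; zero; suc; _≟_)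
open import Data.Vec using (Vec; []; _∷_; toList; map)
open import Data.List using (List; []; _∷_; _++_; concatMap)
open import Data.List.Membership.Propositional using (_∈_)
open import Data.Product using (Σ; _×_; _,_)
open import Data.Sum using (_⊎_)
open import Data.Unit using (⊤)
open import Relation.Nullary using (¬_; yes; no)
open import Relation.Binary.PropositionalEquality using (_≡_; _≢_)
open import Relation.Binary.Construct.Closure.ReflexiveTransitive using (Star)

-- Signature: countably many relation names of every arity ≥ 1.
-- rel k i is the i-th relation name of arity (suc k).

data RelName : Set where
  rel : (k i : ℕ) → RelName

ar : RelName → ℕ
ar (rel k i) = suc k

record Structure : Set₁ where
  field
    D   : Set
    Rel : (R : RelName) → Vec D (ar R) → Set
open Structure public

IsKripke : Structure → Set
IsKripke K = ∀ k i (us : Vec (D K) (suc (suc (suc k)))) → ¬ Rel K (rel (suc (suc k)) i) us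

_⇔_ : Set → Set → Set
A ⇔ B = (A → B) × (B → A)

data Guard : Set where
  gatom : (R : RelName) → Vec ℕ (ar R) → Guard
  geq   : ℕ → ℕ → Guard

data GNFO : Set where
  atom : (R : RelName) → Vec ℕ (ar R) → GNFO
  eq   : ℕ → ℕ → GNFO
  _∨_  : GNFO → GNFO → GNFO
  _∧_  : GNFO → GNFO → GNFO
  ex   : ℕ → GNFO → GNFO
  gneg : Guard → GNFO → GNFO

gvars : Guard → List ℕ
gvars (gatom R xs) = toList xs
gvars (geq x y) = x ∷ y ∷ []

remove : ℕ → List ℕ → List ℕ
remove x [] = []
remove x (y ∷ ys) with y ≟ x
... | yes _ = remove x ys
... | no _  = y ∷ remove x ys

fv : GNFO → List ℕ
fv (atom R xs) = toList xs
fv (eq x y) = x ∷ y ∷ []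
fv (φ ∨ ψ) = fv φ ++ fv ψ
fv (φ ∧ ψ) = fv φ ++ fv ψ
fv (ex x φ) = remove x (fv φ)
fv (gneg α φ) = gvars α ++ fv φ

WF : GNFO → Set
WF (atom R xs) = ⊤
WF (eq x y) = ⊤
WF (φ ∨ ψ) = WF φ × WF ψ
WF (φ ∧ ψ) = WF φ × WF ψ
WF (ex x φ) = WF φ
WF (gneg α φ) = (∀ z → z ∈ fv φ → z ∈ gvars α) × WF φ

_[_↦_] : {A : Set} → (ℕ → A) → ℕ → A → (ℕ → A)
(ρ [ x ↦ d ]) z with z ≟ x
... | yes _ = d
... | no _  = ρ z

module GSem (K : Structure) where
  satGuard : (ℕ → D K) → Guard → Set
  satGuard ρ (gatom R xs) = Rel K R (map ρ xs)
  satGuard ρ (geq x y) = ρ x ≡ ρ y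

  sat : (ℕ → D K) → GNFO → Set
  sat ρ (atom R xs) = Rel K R (map ρ xs)
  sat ρ (eq x y) = ρ x ≡ ρ y
  sat ρ (φ ∨ ψ) = sat ρ φ ⊎ sat ρ ψ
  sat ρ (φ ∧ ψ) = sat ρ φ × sat ρ ψ
  sat ρ (ex x φ) = Σ (D K) λ d → sat (ρ [ x ↦ d ]) φ
  sat ρ (gneg α φ) = satGuard ρ α × ¬ sat ρ φ
open GSem public

-- assignment x ↦ u, y ↦ v (everything else ↦ v; irrelevant)
assign2 : {A : Set} → ℕ → A → A → (ℕ → A)
assign2 x u v = (λ _ → v) [ x ↦ u ]

data Formula : Set
data Program : Set
data Atom : Set

data Formula where
  prop : ℕ → Formula
  neg  : Formula → Formula
  and  : Formula → Formula → Formula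
  dia  : Program → Formula

data Program where
  eps   : Program
  act   : ℕ → Program
  conv  : ℕ → Program
  univ  : Program
  union : Program → Program → Program
  comp  : Program → Program → Program
  star  : Program → Program
  test  : Formula → Program
  conj  : List Atom → ℕ → ℕ → Program

data Atom where
  patom : Program → ℕ → ℕ → Atom
  ratom : (k i : ℕ) → Vec ℕ (suc (suc (suc k))) → Atom

avars : Atom → List ℕ
avars (patom π x y) = x ∷ y ∷ []
avars (ratom k i xs) = toList xs

Vars : List Atom → List ℕ
Vars C = concatMap avars C

Adj : List Atom → ℕ → ℕ → Set
Adj C x y = Σ Atom λ a → a ∈ C × x ∈ avars a × y ∈ avars a

Connected : List Atom → Set
Connected C = ∀ x y → x ∈ Vars C → y ∈ Vars C → Star (Adj C) x y

wfF : Formula → Set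
wfP : Program → Set
wfAs : List Atom → Set
wfA : Atom → Set

wfF (prop i) = ⊤
wfF (neg φ) = wfF φ
wfF (and φ ψ) = wfF φ × wfF ψ
wfF (dia π) = wfP π

wfP eps = ⊤
wfP (act i) = ⊤
wfP (conv i) = ⊤
wfP univ = ⊤
wfP (union π ρ) = wfP π × wfP ρ
wfP (comp π ρ) = wfP π × wfP ρ
wfP (star π) = wfP π
wfP (test φ) = wfF φ
wfP (conj C s t) = wfAs C × s ∈ Vars C × t ∈ Vars C × Connected C

wfAs [] = ⊤
wfAs (a ∷ as) = wfA a × wfAs as

wfA (patom π x y) = wfP π
wfA (ratom k i xs) = ⊤

module USem (K : Structure) where
  ⟦_⟧F : Formula → D K → Set
  ⟦_⟧P : Program → D K → D K → Set
  satAs : (ℕ → D K) → List Atom → Set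
  satA : (ℕ → D K) → Atom → Set

  ⟦ prop i ⟧F u = Rel K (rel 0 i) (u ∷ [])
  ⟦ neg φ ⟧F u = ¬ ⟦ φ ⟧F u
  ⟦ and φ ψ ⟧F u = ⟦ φ ⟧F u × ⟦ ψ ⟧F u
  ⟦ dia π ⟧F u = Σ (D K) λ v → ⟦ π ⟧P u v

  ⟦ eps ⟧P u v = u ≡ v
  ⟦ act i ⟧P u v = Rel K (rel 1 i) (u ∷ v ∷ [])
  ⟦ conv i ⟧P u v = Rel K (rel 1 i) (v ∷ u ∷ [])
  ⟦ univ ⟧P u v = ⊤
  ⟦ union π ρ ⟧P u v = ⟦ π ⟧P u v ⊎ ⟦ ρ ⟧P u v
  ⟦ comp π ρ ⟧P u v = Σ (D K) λ w → ⟦ π ⟧P u w × ⟦ ρ ⟧P w v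
  ⟦ star π ⟧P u v = Star ⟦ π ⟧P u v
  ⟦ test φ ⟧P u v = u ≡ v × ⟦ φ ⟧F u
  ⟦ conj C s t ⟧P u v = Σ (ℕ → D K) λ f → satAs f C × f s ≡ u × f t ≡ v

  satAs f [] = ⊤
  satAs f (a ∷ as) = satA f a × satAs f as

  satA f (patom π x y) = ⟦ π ⟧P (f x) (f y)
  satA f (ratom k i xs) = Rel K (rel (suc (suc k)) i) (map f xs)
open USem public

record GNFO≤UCPDL⁺ : Set₁ where
  field
    T₁ : (φ : GNFO) (x : ℕ) → WF φ → (∀ z → (z ∈ fv φ) ⇔ (z ≡ x)) → Formula
    T₁-wf : ∀ φ x w e → wfF (T₁ φ x w e)
    T₁-correct : ∀ φ x w e (K : Structure) → IsKripke K → (u : D K) →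
                 sat K (λ _ → u) φ ⇔ ⟦_⟧F K (T₁ φ x w e) u
    T₂ : (φ : GNFO) (x y : ℕ) → WF φ → x ≢ y →
         (∀ z → (z ∈ fv φ) ⇔ ((z ≡ x) ⊎ (z ≡ y))) → Program
    T₂-wf : ∀ φ x y w d e → wfP (T₂ φ x y w d e)
    T₂-correct : ∀ φ x y w d e (K : Structure) → IsKripke K → (u v : D K) →
                 sat K (assign2 x u v) φ ⇔ ⟦_⟧P K (T₂ φ x y w d e) u v

{-# OPTIONS --safe #-}
module Submission where

-- UCPDL⁺ programs are preserved by every endomorphism from a family in which each member can be
-- undone at any given world by another member: negation occurs only in formulas, and there the
-- retracting endomorphism turns preservation into reflection. A four-world Kripke structure with
-- atomic programs a and b carries such a family containing an endomorphism that fixes w₀ and sends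
-- w₁ to w₂, whereas the GNFO formula a(x,y) ∧ ¬ b(x,y) holds at (w₀, w₁) but not at (w₀, w₂).

open import Defs hiding (⟦_⟧F; ⟦_⟧P; satAs; satA)
open import Relation.Nullary using (¬_)
open import Data.Nat using (suc)
open import Data.Vec using (Vec; []; _∷_; map)
open import Data.Vec.Properties using (map-∘)
open import Data.List using ([]; _∷_)
open import Data.List.Membership.Propositional using (_∈_)
open import Data.List.Relation.Unary.Any using (here; there)
open import Data.Product using (Σ; _,_; proj₁; proj₂)
open import Data.Sum using (_⊎_; inj₁; inj₂)
open import Data.Unit using (tt)
open import Data.Empty using (⊥)
open import Function using (_∘_)
open import Relation.Binary.PropositionalEquality using (_≡_; refl; cong; subst; sym)
open import Relation.Binary.Construct.Closure.ReflexiveTransitive using (gmap)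

record RetractableEndomorphisms (K : Structure) : Set₁ where
  field
    Endo      : Set
    apply     : Endo → D K → D K
    preserves : ∀ g R us → Rel K R us → Rel K R (map (apply g) us)
    retract   : ∀ g u → Σ Endo λ g′ → apply g′ (apply g u) ≡ u

module _ {K : Structure} (H : RetractableEndomorphisms K) where
  open RetractableEndomorphisms H
  open USem K

  formula-preserved : ∀ g φ {u} → ⟦ φ ⟧F u → ⟦ φ ⟧F (apply g u)
  formula-reflected : ∀ g φ {u} → ⟦ φ ⟧F (apply g u) → ⟦ φ ⟧F u
  program-preserved : ∀ g π {u v} → ⟦ π ⟧P u v → ⟦ π ⟧P (apply g u) (apply g v)
  atoms-preserved   : ∀ g C {f} → satAs f C → satAs (apply g ∘ f) C

  formula-preserved g (prop i) {u} p = preserves g (rel 0 i) (u ∷ []) p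
  formula-preserved g (neg φ) ¬p p = ¬p (formula-reflected g φ p)
  formula-preserved g (and φ ψ) (p , q) = formula-preserved g φ p , formula-preserved g ψ q
  formula-preserved g (dia π) (v , p) = apply g v , program-preserved g π p

  formula-reflected g φ {u} p with retract g u
  ... | g′ , g′gu≡u = subst ⟦ φ ⟧F g′gu≡u (formula-preserved g′ φ p)

  program-preserved g eps u≡v = cong (apply g) u≡v
  program-preserved g (act i) {u} {v} p = preserves g (rel 1 i) (u ∷ v ∷ []) p
  program-preserved g (conv i) {u} {v} p = preserves g (rel 1 i) (v ∷ u ∷ []) p
  program-preserved g univ tt = tt
  program-preserved g (union π ρ) (inj₁ p) = inj₁ (program-preserved g π p)
  program-preserved g (union π ρ) (inj₂ q) = inj₂ (program-preserved g ρ q)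
  program-preserved g (comp π ρ) (w , p , q) =
    apply g w , program-preserved g π p , program-preserved g ρ q
  program-preserved g (star π) p = gmap (apply g) (program-preserved g π) p
  program-preserved g (test φ) (u≡v , p) = cong (apply g) u≡v , formula-preserved g φ p
  program-preserved g (conj C s t) (f , sat , fs≡u , ft≡v) =
    apply g ∘ f , atoms-preserved g C sat , cong (apply g) fs≡u , cong (apply g) ft≡v

  atoms-preserved g [] tt = tt
  atoms-preserved g (patom π x y ∷ C) (p , ps) = program-preserved g π p , atoms-preserved g C ps
  atoms-preserved g (ratom k i xs ∷ C) {f} (r , ps) =
    subst (Rel K (rel (suc (suc k)) i)) (sym (map-∘ (apply g) f xs))
          (preserves g (rel (suc (suc k)) i) (map f xs) r)
    , atoms-preserved g C ps

data World : Set where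
  w₀ w₁ w₂ w₃ : World

data EdgeA : World → World → Set where
  a₀₁ : EdgeA w₀ w₁
  a₀₂ : EdgeA w₀ w₂
  a₃₁ : EdgeA w₃ w₁

data EdgeB : World → World → Set where
  b₀₂ : EdgeB w₀ w₂
  b₃₁ : EdgeB w₃ w₁

RelK : (R : RelName) → Vec World (ar R) → Set
RelK (rel 1 0) (u ∷ v ∷ []) = EdgeA u v
RelK (rel 1 1) (u ∷ v ∷ []) = EdgeB u v
RelK _ _ = ⊥

K : Structure
K = record { D = World ; Rel = RelK }

K-isKripke : IsKripke K
K-isKripke k i us ()

data EndoK : Set where
  identity fold₀₂ fold₃₁ : EndoK

applyK : EndoK → World → World
applyK identity u = u
applyK fold₀₂ w₀ = w₀
applyK fold₀₂ w₁ = w₂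
applyK fold₀₂ w₂ = w₂
applyK fold₀₂ w₃ = w₀
applyK fold₃₁ w₀ = w₃
applyK fold₃₁ w₁ = w₁
applyK fold₃₁ w₂ = w₁
applyK fold₃₁ w₃ = w₃

applyK-preserves : ∀ g R us → RelK R us → RelK R (map (applyK g) us)
applyK-preserves identity (rel 1 0) (u ∷ v ∷ []) e = e
applyK-preserves fold₀₂ (rel 1 0) (u ∷ v ∷ []) a₀₁ = a₀₂
applyK-preserves fold₀₂ (rel 1 0) (u ∷ v ∷ []) a₀₂ = a₀₂
applyK-preserves fold₀₂ (rel 1 0) (u ∷ v ∷ []) a₃₁ = a₀₂
applyK-preserves fold₃₁ (rel 1 0) (u ∷ v ∷ []) a₀₁ = a₃₁
applyK-preserves fold₃₁ (rel 1 0) (u ∷ v ∷ []) a₀₂ = a₃₁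
applyK-preserves fold₃₁ (rel 1 0) (u ∷ v ∷ []) a₃₁ = a₃₁
applyK-preserves identity (rel 1 1) (u ∷ v ∷ []) e = e
applyK-preserves fold₀₂ (rel 1 1) (u ∷ v ∷ []) b₀₂ = b₀₂
applyK-preserves fold₀₂ (rel 1 1) (u ∷ v ∷ []) b₃₁ = b₀₂
applyK-preserves fold₃₁ (rel 1 1) (u ∷ v ∷ []) b₀₂ = b₃₁
applyK-preserves fold₃₁ (rel 1 1) (u ∷ v ∷ []) b₃₁ = b₃₁

applyK-retract : ∀ g u → Σ EndoK λ g′ → applyK g′ (applyK g u) ≡ u
applyK-retract identity u = identity , refl
applyK-retract fold₀₂ w₀ = identity , refl
applyK-retract fold₀₂ w₁ = fold₃₁ , refl
applyK-retract fold₀₂ w₂ = identity , refl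
applyK-retract fold₀₂ w₃ = fold₃₁ , refl
applyK-retract fold₃₁ w₀ = fold₀₂ , refl
applyK-retract fold₃₁ w₁ = identity , refl
applyK-retract fold₃₁ w₂ = fold₀₂ , refl
applyK-retract fold₃₁ w₃ = identity , refl

endomorphismsK : RetractableEndomorphisms K
endomorphismsK = record
  { Endo = EndoK ; apply = applyK ; preserves = applyK-preserves ; retract = applyK-retract }

a-and-not-b : GNFO
a-and-not-b = gneg (gatom (rel 1 0) (0 ∷ 1 ∷ [])) (atom (rel 1 1) (0 ∷ 1 ∷ []))

a-and-not-b-WF : WF a-and-not-b
a-and-not-b-WF = (λ z z∈ → z∈) , tt

0≢1 : ¬ 0 ≡ 1
0≢1 ()

fv-a-and-not-b : ∀ z → (z ∈ fv a-and-not-b) ⇔ ((z ≡ 0) ⊎ (z ≡ 1))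
fv-a-and-not-b z = to , from
  where
  to : z ∈ fv a-and-not-b → (z ≡ 0) ⊎ (z ≡ 1)
  to (here refl) = inj₁ refl
  to (there (here refl)) = inj₂ refl
  to (there (there (here refl))) = inj₁ refl
  to (there (there (there (here refl)))) = inj₂ refl
  from : (z ≡ 0) ⊎ (z ≡ 1) → z ∈ fv a-and-not-b
  from (inj₁ refl) = here refl
  from (inj₂ refl) = there (here refl)

mainTheorem16 : ¬ GNFO≤UCPDL⁺
mainTheorem16 translation = ¬b₀₂ b₀₂
  where
  open GNFO≤UCPDL⁺ translation
  π = T₂ a-and-not-b 0 1 a-and-not-b-WF 0≢1 fv-a-and-not-b
  correct = T₂-correct a-and-not-b 0 1 a-and-not-b-WF 0≢1 fv-a-and-not-b K K-isKripke

  open USem K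

  π₀₁ : ⟦ π ⟧P w₀ w₁
  π₀₁ = proj₁ (correct w₀ w₁) (a₀₁ , λ ())

  π₀₂ : ⟦ π ⟧P w₀ w₂
  π₀₂ = program-preserved endomorphismsK fold₀₂ π π₀₁

  ¬b₀₂ : ¬ EdgeB w₀ w₂
  ¬b₀₂ = proj₂ (proj₂ (correct w₀ w₂) π₀₂)
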